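{- Let $m\geq 3$ be an integer and $\mathbb{F}_{2^m}^*=\mathbb{F}_{2^m}\setminus\{0\}$. For $3\leq k\leq 2^m-4$ let $W_k=\{B\subseteq \mathbb{F}_{2^m}^* : |B|=k,\ \sum_{x\in B}x=0\}$, let $b_k=|W_k|$, and let $r_k$ be the number of blocks of $W_k$ containing a given point of $\mathbb{F}_{2^m}^*$ (this number does not depend on the point, since $(\mathbb{F}_{2^m}^*,W_k)$ is a balanced incomplete block design). Set $r_{2^m-3}:=0$. Then for $3\leq k\leq 2^m-4$, $$r_{k+1}=\begin{cases} b_k-r_k, & k\equiv 1,3\pmod 4,\\ b_k-r_k+\binom{2^{m-1}-1}{k/2}, & k\equiv 2\pmod 4,\\ b_k-r_k-\binom{2^{m-1}-1}{k/2}, & k\equiv 0\pmod 4.\end{cases}$$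
   Context: $\mathbb{F}_{2^m}$ denotes the finite field with $2^m$ elements. For $3\le k\le 2^m-4$, every pair of distinct points of $\mathbb{F}_{2^m}^*$ lies in the same number $\lambda_k$ of blocks of $W_k$, and consequently every point lies in the same number $r_k=\lambda_k(2^m-2)/(k-1)$ of blocks. -}

module Defs where

open import Data.Bool using (Bool; true; false; _xor_)
open import Data.Bool.Properties using () renaming (_≟_ to _≟B_)
open import Data.Nat using (ℕ; zero; suc; _∸_; _^_)
open import Data.Nat.Properties using () renaming (_≟_ to _≟ℕ_)
open import Data.Vec using (Vec; []; _∷_; zipWith; replicate)
open import Data.Vec.Properties using (≡-dec)
open import Data.List using (List; []; _∷_; map; _++_; length; filter; foldr)
open import Data.Product using (_×_)
open import Relation.Nullary using (¬_; Dec)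
open import Relation.Nullary.Decidable using (_×-dec_; ¬?)
open import Relation.Binary.PropositionalEquality using (_≡_)
import Data.List.Membership.DecPropositional as DecMem

-- The additive group of the field F_{2^m} is (F_2)^m; elements are
-- represented as bit vectors of length m, with addition = componentwise xor.
F : ℕ → Set
F m = Vec Bool m

_≟F_ : ∀ {m} (x y : F m) → Dec (x ≡ y)
_≟F_ = ≡-dec _≟B_

0F : ∀ {m} → F m
0F {m} = replicate m false

_+F_ : ∀ {m} → F m → F m → F m
_+F_ = zipWith _xor_

sumF : ∀ {m} → List (F m) → F m
sumF = foldr _+F_ 0F

allF : (m : ℕ) → List (F m)
allF zero = [] ∷ []
allF (suc m) = map (false ∷_) (allF m) ++ map (true ∷_) (allF m)

Fstar : (m : ℕ) → List (F m)
Fstar m = filter (λ x → ¬? (x ≟F 0F)) (allF m)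

-- All sublists of a list; for a duplicate-free list these are exactly
-- its subsets, each listed once.
sublists : ∀ {A : Set} → List A → List (List A)
sublists [] = [] ∷ []
sublists (x ∷ xs) = sublists xs ++ map (x ∷_) (sublists xs)

W : (m k : ℕ) → List (List (F m))
W m k = filter (λ B → (length B ≟ℕ k) ×-dec (sumF B ≟F 0F)) (sublists (Fstar m))

b : (m k : ℕ) → ℕ
b m k = length (W m k)

rcount : (m k : ℕ) → F m → ℕ
rcount m k x = length (filter (λ B → x ∈? B) (W m k))
  where open DecMem {A = F m} _≟F_

r : (m k : ℕ) → F m → ℕ
r m k x with k ≟ℕ (2 ^ m ∸ 3)
... | Relation.Nullary.yes _ = 0
... | Relation.Nullary.no _ = rcount m k x

-- Fix x ∈ F* and let S = F* ∖ {x}. A (k+1)-block through x is x together with a k-subset of S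
-- summing to x, and a k-block avoiding x is a k-subset of S summing to 0, so
-- r (k+1) − (b k − r k) = N k x − N k 0, where N k s counts the k-subsets of S with sum s.
-- Now S is the disjoint union of the n = 2^(m−1) − 1 pairs {a, a + x}. Swapping the chosen point of
-- a pair met once exchanges the sums s and s + x, while taking both points adds x; hence
-- Σₖ (N k 0 − N k x) tᵏ = (1 − t²)ⁿ, whose coefficient of tᵏ is 0 for odd k and (−1)^(k/2) C(n, k/2)
-- for even k.
module Submission where

open import Defs

-- Natural-number addition is opened only inside this block: below it, _+_ is integer addition, as in the statement.
module _ where
  open import Data.Bool using (Bool; true; false; _xor_; if_then_else_)
  open import Data.Bool.Properties using (xor-assoc; xor-comm; xor-identityˡ; xor-identityʳ; xor-same)
  open import Data.Nat using (ℕ; zero; suc; _+_; _*_; _≤_; _<_; _∸_; _^_; _%_; _/_; s≤s; z≤n)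
  open import Data.Nat.Properties
    using (+-commutativeSemigroup; +-suc; ≤-trans; *-identityˡ; +-comm; +-identityʳ; suc-injective; ≤-reflexive; m<n⇒m<1+n)
    renaming (_≟_ to _≟ℕ_)
  open import Algebra.Properties.CommutativeSemigroup +-commutativeSemigroup
    using () renaming (interchange to ℕ-interchange; xy∙z≈xz∙y to ℕ-xy∙z≈xz∙y)
  open import Data.Nat.DivMod using (m≡m%n+[m/n]*n; m*n/n≡m)
  open import Data.Nat.Tactic.RingSolver using () renaming (solve-∀ to ℕ-solve-∀)
  open import Data.Nat.Combinatorics using (_C_; nCk+nC[k+1]≡[n+1]C[k+1])
  open import Data.Vec using ([]; _∷_)
  open import Data.Vec.Properties
    using (zipWith-assoc; zipWith-comm; zipWith-identityˡ; zipWith-identityʳ; zipWith-inverseˡ; map-id; ∷-injectiveʳ)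
  open import Data.List using (List; []; _∷_; map; _++_; length; filter)
  open import Data.List.Properties using (length-++; length-map; filter-++; filter-≐; filter-all; filter-accept; filter-reject; filter-none)
  open import Data.List.Membership.Propositional using (_∈_; _∉_)
  open import Data.List.Membership.Propositional.Properties
    using (∈-map⁺; ∈-map⁻; ∈-++⁺ˡ; ∈-++⁺ʳ; ∈-++⁻; ∈-filter⁺; ∈-filter⁻)
  open import Data.List.Relation.Unary.Any as Any using (here; there)
  open import Data.List.Relation.Unary.All as All using (All; []; _∷_)
  open import Data.List.Relation.Unary.All.Properties using (All¬⇒¬Any)
  open import Data.List.Relation.Unary.AllPairs using ([]; _∷_)
  open import Data.List.Relation.Unary.Unique.Propositional using (Unique)
  import Data.List.Relation.Unary.Unique.Propositional.Properties as Unique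
  open import Data.List.Relation.Binary.Permutation.Propositional
    using (_↭_; prep; swap; ↭-refl; ↭-reflexive; ↭-trans; module PermutationReasoning)
  open import Data.List.Relation.Binary.Permutation.Propositional.Properties using (↭-length)
  import Data.Integer as ℤ
  open ℤ using (ℤ; +_; -_; _-_; 0ℤ; 1ℤ; -1ℤ)
  open import Data.Integer.Properties using (pos-+; -1*i≡-i)
    renaming (+-identityʳ to ℤ-+-identityʳ; *-zeroʳ to ℤ-*-zeroʳ; *-identityˡ to ℤ-*-identityˡ; +-minus-telescope to ℤ-+-minus-telescope)
  open import Data.Integer.Tactic.RingSolver using (solve-∀)
  open import Data.Product using (_×_; _,_; proj₁; proj₂; ∃-syntax)
  open import Data.Sum using (_⊎_; inj₁; inj₂)
  open import Data.Empty using (⊥-elim)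
  open import Function using (_∘_)
  open import Level using (0ℓ)
  open import Relation.Nullary using (¬_; yes; no; does)
  open import Relation.Nullary.Decidable using (¬?; _×-dec_)
  open import Relation.Unary using (Pred; Decidable; _≐_)
  open import Relation.Binary.PropositionalEquality
    using (_≡_; _≢_; refl; sym; trans; cong; cong₂; subst; module ≡-Reasoning)
  import Data.List.Membership.DecPropositional as DecMembership

  module _ {m : ℕ} where

    +F-assoc : (a b c : F m) → (a +F b) +F c ≡ a +F (b +F c)
    +F-assoc = zipWith-assoc xor-assoc

    +F-comm : (a b : F m) → a +F b ≡ b +F a
    +F-comm = zipWith-comm xor-comm

    +F-identityˡ : (a : F m) → 0F +F a ≡ a
    +F-identityˡ = zipWith-identityˡ xor-identityˡ

    +F-identityʳ : (a : F m) → a +F 0F ≡ a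
    +F-identityʳ = zipWith-identityʳ xor-identityʳ

    +F-same : (a : F m) → a +F a ≡ 0F
    +F-same a = trans (cong (_+F a) (sym (map-id a))) (zipWith-inverseˡ xor-same a)

    +F-cancelˡ : (a b : F m) → a +F (a +F b) ≡ b
    +F-cancelˡ a b = begin
      a +F (a +F b)  ≡⟨ +F-assoc a a b ⟨
      (a +F a) +F b  ≡⟨ cong (_+F b) (+F-same a) ⟩
      0F +F b        ≡⟨ +F-identityˡ b ⟩
      b              ∎
      where open ≡-Reasoning

    +F-cancelʳ : (a b : F m) → (a +F b) +F b ≡ a
    +F-cancelʳ a b = trans (+F-comm (a +F b) b) (trans (cong (b +F_) (+F-comm a b)) (+F-cancelˡ b a))

    +F-cancelˡ-≡ : (a : F m) {b c : F m} → a +F b ≡ a +F c → b ≡ c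
    +F-cancelˡ-≡ a {b} {c} e = trans (sym (+F-cancelˡ a b)) (trans (cong (a +F_) e) (+F-cancelˡ a c))

    +F-cancelʳ-≡ : (c : F m) {a b : F m} → a +F c ≡ b +F c → a ≡ b
    +F-cancelʳ-≡ c {a} {b} e = +F-cancelˡ-≡ c (trans (+F-comm c a) (trans e (+F-comm b c)))

    +F≡0⇒≡ : (a b : F m) → a +F b ≡ 0F → a ≡ b
    +F≡0⇒≡ a b e = +F-cancelˡ-≡ b (trans (+F-comm b a) (trans e (sym (+F-same b))))

    +F-swap : (a b c : F m) → a +F (b +F c) ≡ b +F (a +F c)
    +F-swap a b c = trans (sym (+F-assoc a b c)) (trans (cong (_+F c) (+F-comm a b)) (+F-assoc b a c))

    +F-swapʳ : (a b c : F m) → (a +F b) +F c ≡ (a +F c) +F b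
    +F-swapʳ a b c = trans (+F-assoc a b c) (trans (cong (a +F_) (+F-comm b c)) (sym (+F-assoc a c b)))

    +F-cancelˡ-assoc : (a b c : F m) → a +F ((a +F b) +F c) ≡ b +F c
    +F-cancelˡ-assoc a b c = trans (cong (a +F_) (+F-assoc a b c)) (+F-cancelˡ a (b +F c))

  sumF-++ : ∀ {m} (xs ys : List (F m)) → sumF (xs ++ ys) ≡ sumF xs +F sumF ys
  sumF-++ [] ys = sym (+F-identityˡ _)
  sumF-++ (x ∷ xs) ys = trans (cong (x +F_) (sumF-++ xs ys)) (sym (+F-assoc x _ _))

  sumF-↭ : ∀ {m} {xs ys : List (F m)} → xs ↭ ys → sumF xs ≡ sumF ys
  sumF-↭ _↭_.refl = refl
  sumF-↭ (prep x p) = cong (x +F_) (sumF-↭ p)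
  sumF-↭ (swap x y p) = trans (cong (λ t → x +F (y +F t)) (sumF-↭ p)) (+F-swap x y _)
  sumF-↭ (_↭_.trans p q) = trans (sumF-↭ p) (sumF-↭ q)

  xor-iterate : Bool → ℕ → Bool
  xor-iterate c zero = false
  xor-iterate c (suc n) = c xor xor-iterate c n

  xor-iterate-+ : ∀ c n n′ → xor-iterate c (n + n′) ≡ xor-iterate c n xor xor-iterate c n′
  xor-iterate-+ c zero n′ = refl
  xor-iterate-+ c (suc n) n′ = trans (cong (c xor_) (xor-iterate-+ c n n′)) (sym (xor-assoc c _ _))

  xor-iterate-double : ∀ c n → xor-iterate c (n + n) ≡ false
  xor-iterate-double c n = trans (xor-iterate-+ c n n) (xor-same (xor-iterate c n))

  sumF-map-∷ : ∀ {m} c (xs : List (F m)) → sumF (map (c ∷_) xs) ≡ xor-iterate c (length xs) ∷ sumF xs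
  sumF-map-∷ c [] = refl
  sumF-map-∷ c (x ∷ xs) = cong ((c ∷ x) +F_) (sumF-map-∷ c xs)

  allF-complete : ∀ m (v : F m) → v ∈ allF m
  allF-complete zero [] = here refl
  allF-complete (suc m) (false ∷ v) = ∈-++⁺ˡ (∈-map⁺ (false ∷_) (allF-complete m v))
  allF-complete (suc m) (true ∷ v) = ∈-++⁺ʳ _ (∈-map⁺ (true ∷_) (allF-complete m v))

  allF-unique : ∀ m → Unique (allF m)
  allF-unique zero = [] ∷ []
  allF-unique (suc m) =
    Unique.++⁺ (Unique.map⁺ ∷-injectiveʳ (allF-unique m)) (Unique.map⁺ ∷-injectiveʳ (allF-unique m)) disjoint
    where
    disjoint : ∀ {v} → ¬ (v ∈ map (false ∷_) (allF m) × v ∈ map (true ∷_) (allF m))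
    disjoint (p , q) with ∈-map⁻ (false ∷_) p | ∈-map⁻ (true ∷_) q
    ... | _ , _ , refl | _ , _ , ()

  length-allF-suc : ∀ m → length (allF (suc m)) ≡ length (allF m) + length (allF m)
  length-allF-suc m = trans (length-++ (map (false ∷_) (allF m)))
    (cong₂ _+_ (length-map _ (allF m)) (length-map _ (allF m)))

  length-allF : ∀ m → length (allF m) ≡ 2 ^ m
  length-allF zero = refl
  length-allF (suc m) = trans (length-allF-suc m)
    (cong₂ _+_ (length-allF m) (trans (length-allF m) (sym (+-identityʳ _))))

  -- Each coordinate of F (2 + m) is 1 on exactly half of the elements, an even number of them.
  sumF-allF : ∀ {m} → 2 ≤ m → sumF (allF m) ≡ 0F
  sumF-allF {suc (suc m)} (s≤s (s≤s _)) = begin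
    sumF (map (false ∷_) A ++ map (true ∷_) A)
      ≡⟨ sumF-++ (map (false ∷_) A) (map (true ∷_) A) ⟩
    sumF (map (false ∷_) A) +F sumF (map (true ∷_) A)
      ≡⟨ cong₂ _+F_ (sumF-map-∷ false A) (sumF-map-∷ true A) ⟩
    (xor-iterate false (length A) xor xor-iterate true (length A)) ∷ (sumF A +F sumF A)
      ≡⟨ cong₂ _∷_ (cong₂ _xor_ (evenly false) (evenly true)) (+F-same (sumF A)) ⟩
    false ∷ 0F
      ∎
    where
    open ≡-Reasoning
    A = allF (suc m)
    evenly : ∀ c → xor-iterate c (length A) ≡ false
    evenly c = trans (cong (xor-iterate c) (length-allF-suc m)) (xor-iterate-double c (length (allF m)))

  module _ {m : ℕ} where

    remove : F m → List (F m) → List (F m)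
    remove y = filter (λ v → ¬? (v ≟F y))

    remove-unique : ∀ y {xs} → Unique xs → Unique (remove y xs)
    remove-unique y = Unique.filter⁺ (λ v → ¬? (v ≟F y))

    ∈-remove⁺ : ∀ {y v xs} → v ∈ xs → v ≢ y → v ∈ remove y xs
    ∈-remove⁺ {y} = ∈-filter⁺ (λ v → ¬? (v ≟F y))

    ∈-remove⁻ : ∀ {y v} xs → v ∈ remove y xs → v ∈ xs × v ≢ y
    ∈-remove⁻ {y} xs = ∈-filter⁻ (λ v → ¬? (v ≟F y)) {xs = xs}

    remove-∉ : ∀ {y xs} → y ∉ xs → remove y xs ≡ xs
    remove-∉ {y} y∉xs = filter-all (λ v → ¬? (v ≟F y)) (All.tabulate λ v∈xs v≡y → y∉xs (subst (_∈ _) v≡y v∈xs))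

    ↭-remove : ∀ {y xs} → Unique xs → y ∈ xs → xs ↭ y ∷ remove y xs
    ↭-remove {y} {.y ∷ xs} (y∉xs ∷ _) (here refl) = prep y (↭-reflexive (begin
      xs                  ≡⟨ remove-∉ (All¬⇒¬Any y∉xs) ⟨
      remove y xs         ≡⟨ filter-reject (λ v → ¬? (v ≟F y)) (λ y≢y → y≢y refl) ⟨
      remove y (y ∷ xs)   ∎))
      where open ≡-Reasoning
    ↭-remove {y} {z ∷ xs} (z∉xs ∷ u) (there y∈xs) = begin
      z ∷ xs                 ↭⟨ prep z (↭-remove u y∈xs) ⟩
      z ∷ y ∷ remove y xs    ↭⟨ swap z y ↭-refl ⟩
      y ∷ z ∷ remove y xs    ≡⟨ cong (y ∷_) (filter-accept (λ v → ¬? (v ≟F y)) z≢y) ⟨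
      y ∷ remove y (z ∷ xs)  ∎
      where
      open PermutationReasoning
      z≢y : z ≢ y
      z≢y z≡y = All¬⇒¬Any z∉xs (subst (_∈ xs) (sym z≡y) y∈xs)

  sublists-⊆ : ∀ {A : Set} {B : List A} (xs : List A) → B ∈ sublists xs → ∀ {v} → v ∈ B → v ∈ xs
  sublists-⊆ [] (here refl) ()
  sublists-⊆ (y ∷ xs) B∈ v∈B with ∈-++⁻ (sublists xs) B∈
  ... | inj₁ B∈xs = there (sublists-⊆ xs B∈xs v∈B)
  ... | inj₂ B∈y∷xs with ∈-map⁻ (y ∷_) B∈y∷xs
  ...   | B′ , B′∈xs , refl with v∈B
  ...     | here refl = here refl
  ...     | there v∈B′ = there (sublists-⊆ xs B′∈xs v∈B′)

  module _ {A : Set} where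

    length-filter-map : {P : Pred (List A) 0ℓ} (P? : Decidable P) (f : List A → List A) (Bs : List (List A)) →
      length (filter P? (map f Bs)) ≡ length (filter (P? ∘ f) Bs)
    length-filter-map P? f [] = refl
    length-filter-map P? f (B ∷ Bs) with does (P? (f B))
    ... | true = cong suc (length-filter-map P? f Bs)
    ... | false = length-filter-map P? f Bs

    count-sublists-∷ : {P : Pred (List A) 0ℓ} (P? : Decidable P) (y : A) (xs : List A) →
      length (filter P? (sublists (y ∷ xs)))
        ≡ length (filter P? (sublists xs)) + length (filter (P? ∘ (y ∷_)) (sublists xs))
    count-sublists-∷ P? y xs = begin
      length (filter P? (sublists xs ++ map (y ∷_) (sublists xs)))
        ≡⟨ cong length (filter-++ P? (sublists xs) _) ⟩
      length (filter P? (sublists xs) ++ filter P? (map (y ∷_) (sublists xs)))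
        ≡⟨ length-++ (filter P? (sublists xs)) ⟩
      length (filter P? (sublists xs)) + length (filter P? (map (y ∷_) (sublists xs)))
        ≡⟨ cong (_+_ (length (filter P? (sublists xs)))) (length-filter-map P? (y ∷_) (sublists xs)) ⟩
      length (filter P? (sublists xs)) + length (filter (P? ∘ (y ∷_)) (sublists xs))
        ∎
      where open ≡-Reasoning

    filter-filter : {P Q : Pred (List A) 0ℓ} (P? : Decidable P) (Q? : Decidable Q) (Bs : List (List A)) →
      filter Q? (filter P? Bs) ≡ filter (λ B → P? B ×-dec Q? B) Bs
    filter-filter P? Q? [] = refl
    filter-filter P? Q? (B ∷ Bs) with P? B
    ... | no _ = filter-filter P? Q? Bs
    ... | yes _ with Q? B
    ...   | yes _ = cong (B ∷_) (filter-filter P? Q? Bs)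
    ...   | no _ = filter-filter P? Q? Bs

  -- A sequence f : ℕ → ℤ stands for the power series Σⱼ f j tʲ.
  t²∙ : (ℕ → ℤ) → ℕ → ℤ
  t²∙ f (suc (suc j)) = f j
  t²∙ f _ = 0ℤ

  t²∙-cong : ∀ {f g : ℕ → ℤ} → (∀ j → f j ≡ g j) → ∀ j → t²∙ f j ≡ t²∙ g j
  t²∙-cong f≗g (suc (suc j)) = f≗g j
  t²∙-cong f≗g zero = refl
  t²∙-cong f≗g (suc zero) = refl

  coeff[1-t²]^ : ℕ → ℕ → ℤ
  coeff[1-t²]^ zero zero = 1ℤ
  coeff[1-t²]^ zero (suc j) = 0ℤ
  coeff[1-t²]^ (suc n) j = coeff[1-t²]^ n j - t²∙ (coeff[1-t²]^ n) j

  coeff[1-t²]^-odd : ∀ n i → coeff[1-t²]^ n (suc (i + i)) ≡ 0ℤ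
  coeff[1-t²]^-odd zero i = refl
  coeff[1-t²]^-odd (suc n) zero = cong (_- 0ℤ) (coeff[1-t²]^-odd n zero)
  coeff[1-t²]^-odd (suc n) (suc i) = cong₂ _-_ (coeff[1-t²]^-odd n (suc i))
    (trans (cong (coeff[1-t²]^ n) (+-suc i i)) (coeff[1-t²]^-odd n i))

  coeff[1-t²]^-even : ∀ n i → coeff[1-t²]^ n (i + i) ≡ -1ℤ ℤ.^ i ℤ.* + (n C i)
  coeff[1-t²]^-even zero zero = refl
  coeff[1-t²]^-even zero (suc i) = sym (ℤ-*-zeroʳ (-1ℤ ℤ.^ suc i))
  coeff[1-t²]^-even (suc n) zero = cong (_- 0ℤ) (coeff[1-t²]^-even n zero)
  coeff[1-t²]^-even (suc n) (suc i) = begin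
    coeff[1-t²]^ (suc n) (suc (i + suc i))
      ≡⟨ cong (coeff[1-t²]^ (suc n) ∘ suc) (+-suc i i) ⟩
    coeff[1-t²]^ n (2 + (i + i)) - coeff[1-t²]^ n (i + i)
      ≡⟨ cong (λ k → coeff[1-t²]^ n (suc k) - coeff[1-t²]^ n (i + i)) (+-suc i i) ⟨
    coeff[1-t²]^ n (suc i + suc i) - coeff[1-t²]^ n (i + i)
      ≡⟨ cong₂ _-_ (coeff[1-t²]^-even n (suc i)) (coeff[1-t²]^-even n i) ⟩
    (-1ℤ ℤ.* u) ℤ.* + (n C suc i) - u ℤ.* + (n C i)
      ≡⟨ factor u (+ (n C i)) (+ (n C suc i)) ⟩
    (-1ℤ ℤ.* u) ℤ.* (+ (n C i) ℤ.+ + (n C suc i))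
      ≡⟨ cong ((-1ℤ ℤ.* u) ℤ.*_) (trans (sym (pos-+ (n C i) (n C suc i))) (cong +_ (nCk+nC[k+1]≡[n+1]C[k+1] n i))) ⟩
    (-1ℤ ℤ.* u) ℤ.* + (suc n C suc i)
      ∎
    where
    open ≡-Reasoning
    u = -1ℤ ℤ.^ i
    factor : ∀ u a b → (-1ℤ ℤ.* u) ℤ.* b - u ℤ.* a ≡ (-1ℤ ℤ.* u) ℤ.* (a ℤ.+ b)
    factor = solve-∀

  -1^[i+i]≡1 : ∀ i → -1ℤ ℤ.^ (i + i) ≡ 1ℤ
  -1^[i+i]≡1 zero = refl
  -1^[i+i]≡1 (suc i) =
    trans (cong (λ k → -1ℤ ℤ.^ suc k) (+-suc i i)) (cong (λ u → -1ℤ ℤ.* (-1ℤ ℤ.* u)) (-1^[i+i]≡1 i))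

  [i+i]/2≡i : ∀ i → (i + i) / 2 ≡ i
  [i+i]/2≡i i = trans (cong (_/ 2) (i+i≡i*2 i)) (m*n/n≡m i 2)
    where
    i+i≡i*2 : ∀ i → i + i ≡ i * 2
    i+i≡i*2 = ℕ-solve-∀

  coeff[1-t²]^-4q+2 : ∀ n q → coeff[1-t²]^ n (suc (q + q) + suc (q + q)) ≡ - + (n C suc (q + q))
  coeff[1-t²]^-4q+2 n q = begin
    coeff[1-t²]^ n (suc (q + q) + suc (q + q))     ≡⟨ coeff[1-t²]^-even n (suc (q + q)) ⟩
    -1ℤ ℤ.* -1ℤ ℤ.^ (q + q) ℤ.* + (n C suc (q + q)) ≡⟨ cong (λ u → -1ℤ ℤ.* u ℤ.* + (n C suc (q + q))) (-1^[i+i]≡1 q) ⟩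
    -1ℤ ℤ.* + (n C suc (q + q))                    ≡⟨ -1*i≡-i (+ (n C suc (q + q))) ⟩
    - + (n C suc (q + q))                          ∎
    where open ≡-Reasoning

  coeff[1-t²]^-4q : ∀ n q → coeff[1-t²]^ n ((q + q) + (q + q)) ≡ + (n C (q + q))
  coeff[1-t²]^-4q n q = begin
    coeff[1-t²]^ n ((q + q) + (q + q))     ≡⟨ coeff[1-t²]^-even n (q + q) ⟩
    -1ℤ ℤ.^ (q + q) ℤ.* + (n C (q + q))    ≡⟨ cong (λ u → u ℤ.* + (n C (q + q))) (-1^[i+i]≡1 q) ⟩
    1ℤ ℤ.* + (n C (q + q))                 ≡⟨ ℤ-*-identityˡ (+ (n C (q + q))) ⟩
    + (n C (q + q))                        ∎
    where open ≡-Reasoning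

  coeff[1-t²]^-mod4 : ∀ n k →
    ((k % 4 ≡ 1 ⊎ k % 4 ≡ 3) → coeff[1-t²]^ n k ≡ 0ℤ) ×
    (k % 4 ≡ 2 → coeff[1-t²]^ n k ≡ - + (n C (k / 2))) ×
    (k % 4 ≡ 0 → coeff[1-t²]^ n k ≡ + (n C (k / 2)))
  coeff[1-t²]^-mod4 n k = odd , two-mod4 , zero-mod4
    where
    q = k / 4
    k≡r+q*4 : ∀ {r} → k % 4 ≡ r → k ≡ r + q * 4
    k≡r+q*4 k%4≡r = trans (m≡m%n+[m/n]*n k 4) (cong (_+ q * 4) k%4≡r)
    1+q*4 : ∀ q → 1 + q * 4 ≡ suc ((q + q) + (q + q))
    1+q*4 = ℕ-solve-∀
    3+q*4 : ∀ q → 3 + q * 4 ≡ suc (suc (q + q) + suc (q + q))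
    3+q*4 = ℕ-solve-∀
    2+q*4 : ∀ q → 2 + q * 4 ≡ suc (q + q) + suc (q + q)
    2+q*4 = ℕ-solve-∀
    0+q*4 : ∀ q → 0 + q * 4 ≡ (q + q) + (q + q)
    0+q*4 = ℕ-solve-∀

    odd : (k % 4 ≡ 1 ⊎ k % 4 ≡ 3) → coeff[1-t²]^ n k ≡ 0ℤ
    odd (inj₁ k%4≡1) = trans (cong (coeff[1-t²]^ n) (trans (k≡r+q*4 k%4≡1) (1+q*4 q))) (coeff[1-t²]^-odd n (q + q))
    odd (inj₂ k%4≡3) = trans (cong (coeff[1-t²]^ n) (trans (k≡r+q*4 k%4≡3) (3+q*4 q))) (coeff[1-t²]^-odd n (suc (q + q)))

    two-mod4 : k % 4 ≡ 2 → coeff[1-t²]^ n k ≡ - + (n C (k / 2))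
    two-mod4 k%4≡2 = subst (λ k → coeff[1-t²]^ n k ≡ - + (n C (k / 2))) (sym (trans (k≡r+q*4 k%4≡2) (2+q*4 q)))
      (trans (coeff[1-t²]^-4q+2 n q) (cong (λ j → - + (n C j)) (sym ([i+i]/2≡i (suc (q + q))))))

    zero-mod4 : k % 4 ≡ 0 → coeff[1-t²]^ n k ≡ + (n C (k / 2))
    zero-mod4 k%4≡0 = subst (λ k → coeff[1-t²]^ n k ≡ + (n C (k / 2))) (sym (trans (k≡r+q*4 k%4≡0) (0+q*4 q)))
      (trans (coeff[1-t²]^-4q n q) (cong (λ j → + (n C j)) (sym ([i+i]/2≡i (q + q)))))

  module _ {m : ℕ} where

    #subsets : List (F m) → ℕ → F m → ℕ
    #subsets [] zero s = if does (s ≟F 0F) then 1 else 0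
    #subsets [] (suc j) s = 0
    #subsets (y ∷ xs) zero s = #subsets xs zero s
    #subsets (y ∷ xs) (suc j) s = #subsets xs (suc j) s + #subsets xs j (y +F s)

    sizeSum? : (j : ℕ) (s : F m) → Decidable (λ (B : List (F m)) → length B ≡ j × sumF B ≡ s)
    sizeSum? j s B = (length B ≟ℕ j) ×-dec (sumF B ≟F s)

    sizeSum-∷ : ∀ (y : F m) j s →
      (λ (B : List (F m)) → length (y ∷ B) ≡ suc j × sumF (y ∷ B) ≡ s) ≐ (λ B → length B ≡ j × sumF B ≡ y +F s)
    sizeSum-∷ y j s =
      (λ (len , sum) → suc-injective len , trans (sym (+F-cancelˡ y _)) (cong (y +F_) sum)) ,
      (λ (len , sum) → cong suc len , trans (cong (y +F_) sum) (+F-cancelˡ y s))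

    count-sublists≡#subsets : ∀ xs j s → length (filter (sizeSum? j s) (sublists xs)) ≡ #subsets xs j s
    count-sublists≡#subsets [] zero s with 0F ≟F s | s ≟F 0F
    ... | yes _ | yes _ = refl
    ... | yes 0≡s | no s≢0 = ⊥-elim (s≢0 (sym 0≡s))
    ... | no 0≢s | yes s≡0 = ⊥-elim (0≢s (sym s≡0))
    ... | no _ | no _ = refl
    count-sublists≡#subsets [] (suc j) s = refl
    count-sublists≡#subsets (y ∷ xs) zero s = begin
      length (filter (sizeSum? 0 s) (sublists (y ∷ xs)))
        ≡⟨ count-sublists-∷ (sizeSum? 0 s) y xs ⟩
      length (filter (sizeSum? 0 s) (sublists xs)) + length (filter (sizeSum? 0 s ∘ (y ∷_)) (sublists xs))
        ≡⟨ cong (_+_ (length (filter (sizeSum? 0 s) (sublists xs))))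
             (cong length (filter-none (sizeSum? 0 s ∘ (y ∷_)) {xs = sublists xs} (All.tabulate λ _ ()))) ⟩
      length (filter (sizeSum? 0 s) (sublists xs)) + 0
        ≡⟨ +-identityʳ _ ⟩
      length (filter (sizeSum? 0 s) (sublists xs))
        ≡⟨ count-sublists≡#subsets xs zero s ⟩
      #subsets xs zero s
        ∎
      where open ≡-Reasoning
    count-sublists≡#subsets (y ∷ xs) (suc j) s = begin
      length (filter (sizeSum? (suc j) s) (sublists (y ∷ xs)))
        ≡⟨ count-sublists-∷ (sizeSum? (suc j) s) y xs ⟩
      length (filter (sizeSum? (suc j) s) (sublists xs)) + length (filter (sizeSum? (suc j) s ∘ (y ∷_)) (sublists xs))
        ≡⟨ cong₂ _+_ (count-sublists≡#subsets xs (suc j) s)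
             (trans (cong length (filter-≐ (sizeSum? (suc j) s ∘ (y ∷_)) (sizeSum? j (y +F s)) (sizeSum-∷ y j s) (sublists xs)))
                    (count-sublists≡#subsets xs j (y +F s))) ⟩
      #subsets xs (suc j) s + #subsets xs j (y +F s)
        ∎
      where open ≡-Reasoning

    module _ (x : F m) where
      open DecMembership {A = F m} _≟F_ using (_∈?_)

      #subsets∋ : List (F m) → ℕ → F m → ℕ
      #subsets∋ xs j s = length (filter (λ B → sizeSum? j s B ×-dec x ∈? B) (sublists xs))

      #subsets∋-∌ : ∀ {xs} → x ∉ xs → ∀ j s → #subsets∋ xs j s ≡ 0
      #subsets∋-∌ {xs} x∉xs j s = cong length (filter-none (λ B → sizeSum? j s B ×-dec x ∈? B) {xs = sublists xs}
        (All.tabulate λ B∈ (_ , x∈B) → x∉xs (sublists-⊆ xs B∈ x∈B)))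

      #subsets∋-zero : ∀ xs s → #subsets∋ xs zero s ≡ 0
      #subsets∋-zero xs s = cong length (filter-none (λ B → sizeSum? 0 s B ×-dec x ∈? B) {xs = sublists xs}
        (All.tabulate λ { {[]} _ (_ , ()) ; {_ ∷ _} _ ((() , _) , _) }))

      #subsets∋-∷-self : ∀ {xs} → x ∉ xs → ∀ j s → #subsets∋ (x ∷ xs) (suc j) s ≡ #subsets xs j (x +F s)
      #subsets∋-∷-self {xs} x∉xs j s = begin
        #subsets∋ (x ∷ xs) (suc j) s
          ≡⟨ count-sublists-∷ (λ B → sizeSum? (suc j) s B ×-dec x ∈? B) x xs ⟩
        #subsets∋ xs (suc j) s + length (filter (λ B → sizeSum? (suc j) s (x ∷ B) ×-dec x ∈? x ∷ B) (sublists xs))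
          ≡⟨ cong₂ _+_ (#subsets∋-∌ x∉xs (suc j) s) (cong length (filter-≐ _ (sizeSum? j (x +F s)) with-x (sublists xs))) ⟩
        length (filter (sizeSum? j (x +F s)) (sublists xs))
          ≡⟨ count-sublists≡#subsets xs j (x +F s) ⟩
        #subsets xs j (x +F s)
          ∎
        where
        open ≡-Reasoning
        with-x : (λ B → (length (x ∷ B) ≡ suc j × sumF (x ∷ B) ≡ s) × x ∈ x ∷ B)
               ≐ (λ B → length B ≡ j × sumF B ≡ x +F s)
        with-x = (λ {B} (p , _) → proj₁ (sizeSum-∷ x j s) {B} p) , (λ {B} p → proj₂ (sizeSum-∷ x j s) {B} p , here refl)

      #subsets∋-∷ : ∀ {y} → y ≢ x → ∀ xs j s →
        #subsets∋ (y ∷ xs) (suc j) s ≡ #subsets∋ xs (suc j) s + #subsets∋ xs j (y +F s)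
      #subsets∋-∷ {y} y≢x xs j s = begin
        #subsets∋ (y ∷ xs) (suc j) s
          ≡⟨ count-sublists-∷ (λ B → sizeSum? (suc j) s B ×-dec x ∈? B) y xs ⟩
        #subsets∋ xs (suc j) s + length (filter (λ B → sizeSum? (suc j) s (y ∷ B) ×-dec x ∈? y ∷ B) (sublists xs))
          ≡⟨ cong (_+_ (#subsets∋ xs (suc j) s))
               (cong length (filter-≐ _ (λ B → sizeSum? j (y +F s) B ×-dec x ∈? B) with-y (sublists xs))) ⟩
        #subsets∋ xs (suc j) s + #subsets∋ xs j (y +F s)
          ∎
        where
        open ≡-Reasoning
        with-y : (λ B → (length (y ∷ B) ≡ suc j × sumF (y ∷ B) ≡ s) × x ∈ y ∷ B)
               ≐ (λ B → (length B ≡ j × sumF B ≡ y +F s) × x ∈ B)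
        with-y = (λ { (p , here x≡y) → ⊥-elim (y≢x (sym x≡y))
                    ; {B} (p , there x∈B) → proj₁ (sizeSum-∷ y j s) {B} p , x∈B })
               , (λ {B} (p , x∈B) → proj₂ (sizeSum-∷ y j s) {B} p , there x∈B)

      #subsets∋≡#subsets-remove : ∀ {xs} → Unique xs → x ∈ xs → ∀ j s →
        #subsets∋ xs (suc j) s ≡ #subsets (remove x xs) j (x +F s)
      #subsets∋≡#subsets-remove {y ∷ xs} (y∉xs ∷ u) x∈y∷xs j s with y ≟F x
      ... | yes refl = trans (#subsets∋-∷-self x∉xs j s) (cong (λ r → #subsets r j (x +F s)) (sym (remove-∉ x∉xs)))
        where
        x∉xs = All¬⇒¬Any y∉xs
      ... | no y≢x = trans (#subsets∋-∷ y≢x xs j s) (add-y j)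
        where
        x∈xs : x ∈ xs
        x∈xs = Any.tail (y≢x ∘ sym) x∈y∷xs
        add-y : ∀ j → #subsets∋ xs (suc j) s + #subsets∋ xs j (y +F s) ≡ #subsets (y ∷ remove x xs) j (x +F s)
        add-y zero = trans (cong (_+_ (#subsets∋ xs 1 s)) (#subsets∋-zero xs (y +F s))) (trans (+-identityʳ _)
          (#subsets∋≡#subsets-remove u x∈xs zero s))
        add-y (suc j) = cong₂ _+_ (#subsets∋≡#subsets-remove u x∈xs (suc j) s)
          (trans (#subsets∋≡#subsets-remove u x∈xs j (y +F s)) (cong (#subsets (remove x xs) j) (+F-swap x y s)))

    #subsets-∷-cong : ∀ y {xs ys} → (∀ j s → #subsets xs j s ≡ #subsets ys j s) →
      ∀ j s → #subsets (y ∷ xs) j s ≡ #subsets (y ∷ ys) j s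
    #subsets-∷-cong y eq zero s = eq zero s
    #subsets-∷-cong y eq (suc j) s = cong₂ _+_ (eq (suc j) s) (eq j (y +F s))

    #subsets-swap : ∀ y z xs j s → #subsets (y ∷ z ∷ xs) j s ≡ #subsets (z ∷ y ∷ xs) j s
    #subsets-swap y z xs zero s = refl
    #subsets-swap y z xs (suc zero) s = ℕ-xy∙z≈xz∙y (#subsets xs 1 s) _ _
    #subsets-swap y z xs (suc (suc j)) s = begin
      (#xs (2 + j) s + #xs (suc j) (z +F s)) + (#xs (suc j) (y +F s) + #xs j (z +F (y +F s)))
        ≡⟨ cong (λ t → (#xs (2 + j) s + #xs (suc j) (z +F s)) + (#xs (suc j) (y +F s) + #xs j t)) (+F-swap z y s) ⟩
      (#xs (2 + j) s + #xs (suc j) (z +F s)) + (#xs (suc j) (y +F s) + #xs j (y +F (z +F s)))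
        ≡⟨ ℕ-interchange (#xs (2 + j) s) _ _ _ ⟩
      (#xs (2 + j) s + #xs (suc j) (y +F s)) + (#xs (suc j) (z +F s) + #xs j (y +F (z +F s)))
        ∎
      where
      open ≡-Reasoning
      #xs = #subsets xs

    #subsets-↭ : ∀ {xs ys} → xs ↭ ys → ∀ j s → #subsets xs j s ≡ #subsets ys j s
    #subsets-↭ _↭_.refl j s = refl
    #subsets-↭ (prep y p) = #subsets-∷-cong y (#subsets-↭ p)
    #subsets-↭ (swap y z p) j s =
      trans (#subsets-∷-cong y (#subsets-∷-cong z (#subsets-↭ p)) j s) (#subsets-swap y z _ j s)
    #subsets-↭ (_↭_.trans p q) j s = trans (#subsets-↭ p j s) (#subsets-↭ q j s)

    #subsets-oversize : ∀ xs j s → length xs < j → #subsets xs j s ≡ 0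
    #subsets-oversize [] (suc j) s _ = refl
    #subsets-oversize (y ∷ xs) (suc j) s (s≤s |xs|<j) =
      cong₂ _+_ (#subsets-oversize xs (suc j) s (m<n⇒m<1+n |xs|<j)) (#subsets-oversize xs j (y +F s) |xs|<j)

    #subsets-complement : ∀ xs i j s → i + j ≡ length xs → #subsets xs i s ≡ #subsets xs j (sumF xs +F s)
    #subsets-complement [] zero zero s _ = cong (#subsets [] zero) (sym (+F-identityˡ s))
    #subsets-complement (y ∷ xs) zero (suc j) s len = begin
      #subsets xs zero s
        ≡⟨ #subsets-complement xs zero j s (suc-injective len) ⟩
      #subsets xs j (sumF xs +F s)
        ≡⟨ cong (#subsets xs j) (+F-cancelˡ-assoc y (sumF xs) s) ⟨
      #subsets xs j (y +F ((y +F sumF xs) +F s))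
        ≡⟨ cong (_+ #subsets xs j (y +F ((y +F sumF xs) +F s)))
             (#subsets-oversize xs (suc j) _ (s≤s (≤-reflexive (sym (suc-injective len))))) ⟨
      #subsets xs (suc j) ((y +F sumF xs) +F s) + #subsets xs j (y +F ((y +F sumF xs) +F s))
        ∎
      where open ≡-Reasoning
    #subsets-complement (y ∷ xs) (suc i) zero s len = begin
      #subsets xs (suc i) s + #subsets xs i (y +F s)
        ≡⟨ cong (_+ #subsets xs i (y +F s))
             (#subsets-oversize xs (suc i) s (s≤s (≤-reflexive (trans (sym |xs|≡i+0) (+-identityʳ i))))) ⟩
      #subsets xs i (y +F s)
        ≡⟨ #subsets-complement xs i zero (y +F s) |xs|≡i+0 ⟩
      #subsets xs zero (sumF xs +F (y +F s))
        ≡⟨ cong (#subsets xs zero) (trans (+F-swap (sumF xs) y s) (sym (+F-assoc y (sumF xs) s))) ⟩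
      #subsets xs zero ((y +F sumF xs) +F s)
        ∎
      where
      open ≡-Reasoning
      |xs|≡i+0 : i + 0 ≡ length xs
      |xs|≡i+0 = suc-injective len
    #subsets-complement (y ∷ xs) (suc i) (suc j) s len = begin
      #subsets xs (suc i) s + #subsets xs i (y +F s)
        ≡⟨ cong₂ _+_ (#subsets-complement xs (suc i) j s (trans (sym (+-suc i j)) (suc-injective len)))
                     (#subsets-complement xs i (suc j) (y +F s) (suc-injective len)) ⟩
      #subsets xs j (sumF xs +F s) + #subsets xs (suc j) (sumF xs +F (y +F s))
        ≡⟨ cong₂ _+_ (cong (#subsets xs j) (sym (+F-cancelˡ-assoc y (sumF xs) s))) (cong (#subsets xs (suc j)) (move-y s)) ⟩
      #subsets xs j (y +F ((y +F sumF xs) +F s)) + #subsets xs (suc j) ((y +F sumF xs) +F s)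
        ≡⟨ +-comm (#subsets xs j (y +F ((y +F sumF xs) +F s))) _ ⟩
      #subsets xs (suc j) ((y +F sumF xs) +F s) + #subsets xs j (y +F ((y +F sumF xs) +F s))
        ∎
      where
      open ≡-Reasoning
      move-y : ∀ s → sumF xs +F (y +F s) ≡ (y +F sumF xs) +F s
      move-y s = trans (+F-swap (sumF xs) y s) (sym (+F-assoc y (sumF xs) s))

    #subsets-empty : ∀ xs {s} → s ≢ 0F → #subsets xs zero s ≡ 0
    #subsets-empty [] {s} s≢0 with s ≟F 0F
    ... | yes s≡0 = ⊥-elim (s≢0 s≡0)
    ... | no _ = refl
    #subsets-empty (y ∷ xs) s≢0 = #subsets-empty xs s≢0

    #subsets-singleton : ∀ {xs y} → y ∉ xs → #subsets xs 1 y ≡ 0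
    #subsets-singleton {[]} y∉xs = refl
    #subsets-singleton {z ∷ xs} {y} y∉z∷xs = cong₂ _+_ (#subsets-singleton (y∉z∷xs ∘ there))
      (#subsets-empty xs (λ z+y≡0 → y∉z∷xs (here (sym (+F≡0⇒≡ z y z+y≡0)))))

    #subsets-pair-zero : ∀ {xs} → Unique xs → #subsets xs 2 0F ≡ 0
    #subsets-pair-zero {[]} _ = refl
    #subsets-pair-zero {y ∷ xs} (y∉xs ∷ u) = cong₂ _+_ (#subsets-pair-zero u)
      (trans (cong (#subsets xs 1) (+F-identityʳ y)) (#subsets-singleton (All¬⇒¬Any y∉xs)))

    Δ : F m → List (F m) → ℕ → F m → ℤ
    Δ x xs j s = + #subsets xs j s - + #subsets xs j (s +F x)

    module _ (x : F m) where

      Δ-translate : ∀ xs j s → Δ x xs j (s +F x) ≡ - Δ x xs j s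
      Δ-translate xs j s = begin
        + #subsets xs j (s +F x) - + #subsets xs j ((s +F x) +F x)
          ≡⟨ cong (λ t → + #subsets xs j (s +F x) - + #subsets xs j t) (+F-cancelʳ s x) ⟩
        + #subsets xs j (s +F x) - + #subsets xs j s
          ≡⟨ minus-swap (+ #subsets xs j (s +F x)) (+ #subsets xs j s) ⟩
        - (+ #subsets xs j s - + #subsets xs j (s +F x))
          ∎
        where
        open ≡-Reasoning
        minus-swap : ∀ a b → a - b ≡ - (b - a)
        minus-swap = solve-∀

      Δ-partner : ∀ a xs j s → Δ x xs j ((a +F x) +F s) ≡ - Δ x xs j (a +F s)
      Δ-partner a xs j s = trans (cong (Δ x xs j) (+F-swapʳ a x s)) (Δ-translate xs j (a +F s))

      Δ-∷ : ∀ y xs j s → Δ x (y ∷ xs) (suc j) s ≡ Δ x xs (suc j) s ℤ.+ Δ x xs j (y +F s)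
      Δ-∷ y xs j s = begin
        + (p + q) - + (p′ + q′)          ≡⟨ cong₂ _-_ (pos-+ p q) (pos-+ p′ q′) ⟩
        (+ p ℤ.+ + q) - (+ p′ ℤ.+ + q′)  ≡⟨ interchange-minus (+ p) (+ q) (+ p′) (+ q′) ⟩
        (+ p - + p′) ℤ.+ (+ q - + q′)    ≡⟨ cong (λ t → (+ p - + p′) ℤ.+ (+ q - + #subsets xs j t)) (sym (+F-assoc y s x)) ⟩
        Δ x xs (suc j) s ℤ.+ Δ x xs j (y +F s)
          ∎
        where
        open ≡-Reasoning
        p = #subsets xs (suc j) s
        q = #subsets xs j (y +F s)
        p′ = #subsets xs (suc j) (s +F x)
        q′ = #subsets xs j (y +F (s +F x))
        interchange-minus : ∀ a b c d → (a ℤ.+ b) - (c ℤ.+ d) ≡ (a - c) ℤ.+ (b - d)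
        interchange-minus = solve-∀

      pairUp : List (F m) → List (F m)
      pairUp [] = []
      pairUp (a ∷ as) = a ∷ (a +F x) ∷ pairUp as

      -- Subsets meeting the pair once cancel in Δ (swapping a and a + x moves s to s + x); those
      -- containing both have sum shifted by x, contributing − Δ two sizes lower.
      Δ-pair : ∀ a xs j s → Δ x (a ∷ (a +F x) ∷ xs) j s ≡ Δ x xs j s - t²∙ (λ i → Δ x xs i s) j
      Δ-pair a xs zero s = sym (ℤ-+-identityʳ (Δ x xs zero s))
      Δ-pair a xs (suc zero) s = begin
        Δ x (a ∷ (a +F x) ∷ xs) 1 s
          ≡⟨ Δ-∷ a ((a +F x) ∷ xs) 0 s ⟩
        Δ x ((a +F x) ∷ xs) 1 s ℤ.+ Δ x xs 0 (a +F s)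
          ≡⟨ cong (ℤ._+ Δ x xs 0 (a +F s)) (Δ-∷ (a +F x) xs 0 s) ⟩
        (Δ x xs 1 s ℤ.+ Δ x xs 0 ((a +F x) +F s)) ℤ.+ Δ x xs 0 (a +F s)
          ≡⟨ cong (λ d → (Δ x xs 1 s ℤ.+ d) ℤ.+ Δ x xs 0 (a +F s)) (Δ-partner a xs 0 s) ⟩
        (Δ x xs 1 s ℤ.+ - Δ x xs 0 (a +F s)) ℤ.+ Δ x xs 0 (a +F s)
          ≡⟨ cancel (Δ x xs 1 s) (Δ x xs 0 (a +F s)) ⟩
        Δ x xs 1 s - 0ℤ
          ∎
        where
        open ≡-Reasoning
        cancel : ∀ d p → (d ℤ.+ - p) ℤ.+ p ≡ d - 0ℤ
        cancel = solve-∀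
      Δ-pair a xs (suc (suc i)) s = begin
        Δ x (a ∷ (a +F x) ∷ xs) (2 + i) s
          ≡⟨ Δ-∷ a ((a +F x) ∷ xs) (suc i) s ⟩
        Δ x ((a +F x) ∷ xs) (2 + i) s ℤ.+ Δ x ((a +F x) ∷ xs) (suc i) (a +F s)
          ≡⟨ cong₂ ℤ._+_ (Δ-∷ (a +F x) xs (suc i) s) (Δ-∷ (a +F x) xs i (a +F s)) ⟩
        (Δ x xs (2 + i) s ℤ.+ Δ x xs (suc i) ((a +F x) +F s)) ℤ.+ (Δ x xs (suc i) (a +F s) ℤ.+ Δ x xs i ((a +F x) +F (a +F s)))
          ≡⟨ cong₂ (λ d d′ → (Δ x xs (2 + i) s ℤ.+ d) ℤ.+ (Δ x xs (suc i) (a +F s) ℤ.+ d′))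
                   (Δ-partner a xs (suc i) s) (trans (cong (Δ x xs i) (pair-sum a s)) (Δ-translate xs i s)) ⟩
        (Δ x xs (2 + i) s ℤ.+ - Δ x xs (suc i) (a +F s)) ℤ.+ (Δ x xs (suc i) (a +F s) ℤ.+ - Δ x xs i s)
          ≡⟨ ℤ-+-minus-telescope (Δ x xs (2 + i) s) (Δ x xs (suc i) (a +F s)) (Δ x xs i s) ⟩
        Δ x xs (2 + i) s - Δ x xs i s
          ∎
        where
        open ≡-Reasoning
        pair-sum : ∀ a s → (a +F x) +F (a +F s) ≡ s +F x
        pair-sum a s = trans (+F-assoc a x (a +F s)) (trans (cong (a +F_) (+F-swap x a s))
          (trans (+F-cancelˡ a (x +F s)) (+F-comm x s)))

      Δ-pairUp : x ≢ 0F → ∀ as j → Δ x (pairUp as) j 0F ≡ coeff[1-t²]^ (length as) j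
      Δ-pairUp x≢0 [] zero with 0F {m} ≟F 0F | (0F +F x) ≟F 0F
      ... | yes _ | no _ = refl
      ... | no 0≢0 | _ = ⊥-elim (0≢0 refl)
      ... | _ | yes 0+x≡0 = ⊥-elim (x≢0 (trans (sym (+F-identityˡ x)) 0+x≡0))
      Δ-pairUp x≢0 [] (suc j) = refl
      Δ-pairUp x≢0 (a ∷ as) j = begin
        Δ x (a ∷ (a +F x) ∷ pairUp as) j 0F
          ≡⟨ Δ-pair a (pairUp as) j 0F ⟩
        Δ x (pairUp as) j 0F - t²∙ (λ i → Δ x (pairUp as) i 0F) j
          ≡⟨ cong₂ _-_ (Δ-pairUp x≢0 as j) (t²∙-cong (Δ-pairUp x≢0 as) j) ⟩
        coeff[1-t²]^ (length as) j - t²∙ (coeff[1-t²]^ (length as)) j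
          ∎
        where open ≡-Reasoning

      Closed : List (F m) → Set
      Closed xs = ∀ {v} → v ∈ xs → v +F x ∈ xs

      ↭-pairUp : x ≢ 0F → ∀ n {xs} → length xs ≡ n + n → Unique xs → Closed xs →
        ∃[ as ] (length as ≡ n × xs ↭ pairUp as)
      ↭-pairUp x≢0 zero {[]} _ _ _ = [] , refl , ↭-refl
      ↭-pairUp x≢0 (suc n) {a ∷ xs} len (a∉xs ∷ u) closed =
        let as , |as|≡n , rest↭as = ↭-pairUp x≢0 n |rest|≡n+n (remove-unique (a +F x) u) rest-closed
        in a ∷ as , cong suc |as|≡n , prep a (↭-trans xs↭ (prep (a +F x) rest↭as))
        where
        a+x∈xs : a +F x ∈ xs
        a+x∈xs with closed (here refl)
        ... | here a+x≡a = ⊥-elim (x≢0 (+F-cancelˡ-≡ a (trans a+x≡a (sym (+F-identityʳ a)))))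
        ... | there a+x∈xs = a+x∈xs
        rest = remove (a +F x) xs
        xs↭ : xs ↭ (a +F x) ∷ rest
        xs↭ = ↭-remove u a+x∈xs
        |rest|≡n+n : length rest ≡ n + n
        |rest|≡n+n = suc-injective (suc-injective (begin
          suc (suc (length rest))  ≡⟨ cong suc (↭-length xs↭) ⟨
          suc (length xs)          ≡⟨ len ⟩
          suc (n + suc n)          ≡⟨ cong suc (+-suc n n) ⟩
          suc (suc (n + n))        ∎))
          where open ≡-Reasoning
        rest-closed : Closed rest
        rest-closed v∈rest with v∈xs , v≢a+x ← ∈-remove⁻ xs v∈rest with closed (there v∈xs)
        ... | here v+x≡a = ⊥-elim (v≢a+x (trans (sym (+F-cancelʳ _ x)) (cong (_+F x) v+x≡a)))
        ... | there v+x∈xs = ∈-remove⁺ v+x∈xs λ v+x≡a+x →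
                All¬⇒¬Any a∉xs (subst (_∈ xs) (+F-cancelʳ-≡ x v+x≡a+x) v∈xs)

      Δ-closed : x ≢ 0F → ∀ n {xs} → length xs ≡ n + n → Unique xs → Closed xs →
        ∀ j → Δ x xs j 0F ≡ coeff[1-t²]^ n j
      Δ-closed x≢0 n {xs} len u closed j
        with as , |as|≡n , xs↭as ← ↭-pairUp x≢0 n len u closed = begin
        Δ x xs j 0F              ≡⟨ cong₂ _-_ (cong +_ (#subsets-↭ xs↭as j 0F)) (cong +_ (#subsets-↭ xs↭as j (0F +F x))) ⟩
        Δ x (pairUp as) j 0F     ≡⟨ Δ-pairUp x≢0 as j ⟩
        coeff[1-t²]^ (length as) j ≡⟨ cong (λ k → coeff[1-t²]^ k j) |as|≡n ⟩
        coeff[1-t²]^ n j         ∎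
        where open ≡-Reasoning

  module _ {m : ℕ} (x : F m) (x∈F* : x ∈ Fstar m) where
    open DecMembership {A = F m} _≟F_ using (_∈?_)

    S : List (F m)
    S = remove x (Fstar m)

    private
      F*-unique : Unique (Fstar m)
      F*-unique = remove-unique 0F (allF-unique m)

      x≢0 : x ≢ 0F
      x≢0 = proj₂ (∈-remove⁻ (allF m) x∈F*)

      S-unique : Unique S
      S-unique = remove-unique x F*-unique

      F*↭x∷S : Fstar m ↭ x ∷ S
      F*↭x∷S = ↭-remove F*-unique x∈F*

      allF↭0∷F* : allF m ↭ 0F ∷ Fstar m
      allF↭0∷F* = ↭-remove (allF-unique m) (allF-complete m 0F)

    2+|S|≡2^m : suc (suc (length S)) ≡ 2 ^ m
    2+|S|≡2^m = begin
      suc (suc (length S))  ≡⟨ cong suc (↭-length F*↭x∷S) ⟨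
      suc (length (Fstar m)) ≡⟨ ↭-length allF↭0∷F* ⟨
      length (allF m)       ≡⟨ length-allF m ⟩
      2 ^ m                 ∎
      where open ≡-Reasoning

    sumF-S : 2 ≤ m → sumF S ≡ x
    sumF-S 2≤m = sym (+F≡0⇒≡ x (sumF S) (begin
      x +F sumF S            ≡⟨ +F-identityˡ _ ⟨
      0F +F (x +F sumF S)    ≡⟨ sumF-↭ (↭-trans allF↭0∷F* (prep 0F F*↭x∷S)) ⟨
      sumF (allF m)          ≡⟨ sumF-allF 2≤m ⟩
      0F                     ∎))
      where open ≡-Reasoning

    S-closed : Closed x S
    S-closed {v} v∈S with v∈F* , v≢x ← ∈-remove⁻ (Fstar m) v∈S with _ , v≢0 ← ∈-remove⁻ (allF m) v∈F* =
      ∈-remove⁺ (∈-remove⁺ (allF-complete m (v +F x)) λ v+x≡0 → v≢x (+F≡0⇒≡ v x v+x≡0))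
        λ v+x≡x → v≢0 (+F-cancelʳ-≡ x (trans v+x≡x (sym (+F-identityˡ x))))

    b≡#subsets : ∀ j → b m (suc j) ≡ #subsets S (suc j) 0F + #subsets S j x
    b≡#subsets j = begin
      b m (suc j)                                   ≡⟨ count-sublists≡#subsets (Fstar m) (suc j) 0F ⟩
      #subsets (Fstar m) (suc j) 0F                 ≡⟨ #subsets-↭ F*↭x∷S (suc j) 0F ⟩
      #subsets S (suc j) 0F + #subsets S j (x +F 0F) ≡⟨ cong (_+_ (#subsets S (suc j) 0F) ∘ #subsets S j) (+F-identityʳ x) ⟩
      #subsets S (suc j) 0F + #subsets S j x        ∎
      where open ≡-Reasoning

    rcount≡#subsets : ∀ j → rcount m (suc j) x ≡ #subsets S j x
    rcount≡#subsets j = begin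
      rcount m (suc j) x
        ≡⟨ cong length (filter-filter (sizeSum? (suc j) 0F) (x ∈?_) (sublists (Fstar m))) ⟩
      #subsets∋ x (Fstar m) (suc j) 0F
        ≡⟨ #subsets∋≡#subsets-remove x F*-unique x∈F* j 0F ⟩
      #subsets S j (x +F 0F)
        ≡⟨ cong (#subsets S j) (+F-identityʳ x) ⟩
      #subsets S j x
        ∎
      where open ≡-Reasoning

    |S|≡n+n : 1 ≤ m → length S ≡ (2 ^ (m ∸ 1) ∸ 1) + (2 ^ (m ∸ 1) ∸ 1)
    |S|≡n+n (s≤s {n = m′} _) = halve (2 ^ m′) (trans 2+|S|≡2^m (cong (_+_ (2 ^ m′)) (*-identityˡ (2 ^ m′))))
      where
      halve : ∀ a → suc (suc (length S)) ≡ a + a → length S ≡ (a ∸ 1) + (a ∸ 1)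
      halve (suc a) 2+|S|≡2+2a = suc-injective (suc-injective (trans 2+|S|≡2+2a (cong suc (+-suc a a))))

    -- The convention r (2 ^ m ∸ 3) = 0 agrees with the count: sets of size 2 ^ m ∸ 4 = |S| - 2 in S summing
    -- to x are the complements of pairs summing to sumF S + x = 0.
    r-suc≡#subsets : 2 ≤ m → ∀ k → r m (suc k) x ≡ #subsets S k x
    r-suc≡#subsets 2≤m k with suc k ≟ℕ 2 ^ m ∸ 3
    ... | no _ = rcount≡#subsets k
    ... | yes 1+k≡2^m∸3 = sym (begin
      #subsets S k x               ≡⟨ #subsets-complement S k 2 x k+2≡|S| ⟩
      #subsets S 2 (sumF S +F x)   ≡⟨ cong (#subsets S 2) (trans (cong (_+F x) (sumF-S 2≤m)) (+F-same x)) ⟩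
      #subsets S 2 0F              ≡⟨ #subsets-pair-zero S-unique ⟩
      0                            ∎)
      where
      open ≡-Reasoning
      k+2≡ : ∀ L → suc k ≡ suc (suc L) ∸ 3 → k + 2 ≡ L
      k+2≡ (suc (suc L)) refl = +-comm L 2
      k+2≡|S| : k + 2 ≡ length S
      k+2≡|S| = k+2≡ (length S) (trans 1+k≡2^m∸3 (cong (_∸ 3) (sym 2+|S|≡2^m)))

    b-r≡#subsets : 2 ≤ m → ∀ k → + b m (suc k) - + r m (suc k) x ≡ + #subsets S (suc k) 0F
    b-r≡#subsets 2≤m k = begin
      + b m (suc k) - + r m (suc k) x
        ≡⟨ cong₂ (λ p q → + p - + q) (b≡#subsets k) (r-suc≡#subsets 2≤m k) ⟩
      + (#subsets S (suc k) 0F + #subsets S k x) - + #subsets S k x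
        ≡⟨ cong (_- + #subsets S k x) (pos-+ (#subsets S (suc k) 0F) (#subsets S k x)) ⟩
      (+ #subsets S (suc k) 0F ℤ.+ + #subsets S k x) - + #subsets S k x
        ≡⟨ add-sub (+ #subsets S (suc k) 0F) (+ #subsets S k x) ⟩
      + #subsets S (suc k) 0F
        ∎
      where
      open ≡-Reasoning
      add-sub : ∀ a c → (a ℤ.+ c) - c ≡ a
      add-sub = solve-∀

    Δ-S : 1 ≤ m → ∀ j → Δ x S j 0F ≡ coeff[1-t²]^ (2 ^ (m ∸ 1) ∸ 1) j
    Δ-S 1≤m = Δ-closed x x≢0 (2 ^ (m ∸ 1) ∸ 1) (|S|≡n+n 1≤m) S-unique S-closed

    r-recurrence : 2 ≤ m → ∀ k →
      + r m (suc (suc k)) x ≡ (+ b m (suc k) - + r m (suc k) x) - coeff[1-t²]^ (2 ^ (m ∸ 1) ∸ 1) (suc k)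
    r-recurrence 2≤m k = begin
      + r m (suc (suc k)) x                       ≡⟨ cong +_ (r-suc≡#subsets 2≤m (suc k)) ⟩
      + #subsets S (suc k) x                      ≡⟨ cong (+_ ∘ #subsets S (suc k)) (+F-identityˡ x) ⟨
      + #subsets S (suc k) (0F +F x)              ≡⟨ minus-minus (+ #subsets S (suc k) (0F +F x)) (+ #subsets S (suc k) 0F) ⟩
      + #subsets S (suc k) 0F - Δ x S (suc k) 0F  ≡⟨ cong₂ _-_ (sym (b-r≡#subsets 2≤m k)) (Δ-S (≤-trans (s≤s z≤n) 2≤m) (suc k)) ⟩
      (+ b m (suc k) - + r m (suc k) x) - coeff[1-t²]^ (2 ^ (m ∸ 1) ∸ 1) (suc k)
        ∎
      where
      open ≡-Reasoning
      minus-minus : ∀ a c → a ≡ c - (c - a)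
      minus-minus = solve-∀

open import Data.Nat using (ℕ; zero; suc; _≤_; _∸_; _^_; _%_; _/_)
open import Data.Nat.Properties using (<⇒≤)
open import Data.Nat.Combinatorics using (_C_)
open import Data.Integer using (ℤ; +_; _+_; _-_)
open import Data.Integer.Properties using (+-identityʳ; neg-involutive)
open import Data.List.Membership.Propositional using (_∈_)
open import Data.Product using (_×_; _,_)
open import Data.Sum using (_⊎_)
open import Relation.Binary.PropositionalEquality using (_≡_; trans; cong)

theorem2p9 : (m : ℕ) → 3 ≤ m → (k : ℕ) → 3 ≤ k → k ≤ 2 ^ m ∸ 4 →
    (x : F m) → x ∈ Fstar m →
      ((k % 4 ≡ 1 ⊎ k % 4 ≡ 3) →
        + r m (ℕ.suc k) x ≡ + b m k - + r m k x)
    × (k % 4 ≡ 2 →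
        + r m (ℕ.suc k) x ≡ (+ b m k - + r m k x) + + ((2 ^ (m ∸ 1) ∸ 1) C (k / 2)))
    × (k % 4 ≡ 0 →
        + r m (ℕ.suc k) x ≡ (+ b m k - + r m k x) - + ((2 ^ (m ∸ 1) ∸ 1) C (k / 2)))
theorem2p9 m 3≤m zero () _ _ _
theorem2p9 m 3≤m (suc k) _ _ x x∈F*
  with odd , two , divisible ← coeff[1-t²]^-mod4 (2 ^ (m ∸ 1) ∸ 1) (suc k) =
    (λ k%4≡1∨3 → trans recurrence (trans (cong (_-_ base) (odd k%4≡1∨3)) (+-identityʳ base))) ,
    (λ k%4≡2 → trans recurrence (trans (cong (_-_ base) (two k%4≡2)) (cong (_+_ base) (neg-involutive _)))) ,
    (λ k%4≡0 → trans recurrence (cong (_-_ base) (divisible k%4≡0)))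
  where
  base = + b m (suc k) - + r m (suc k) x
  recurrence = r-recurrence x x∈F* (<⇒≤ 3≤m) k
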